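{- Let $k$ be an integer with $k \ge 2$. Then $G$ is a cograph minimal $(\infty,k)$-polar obstruction of type $(k+2,k+1)$ if and only if $G \cong (k+1)K_1 + H$, where $H$ is isomorphic to $K_{k+1,k+1}$ or to $K_1 \oplus C_4$.
   Context: All graphs are finite and simple. A cograph is a graph with no induced subgraph isomorphic to $P_4$. $G+H$ denotes disjoint union, $G \oplus H$ the join (disjoint union plus all edges between $G$ and $H$), $nG$ the disjoint union of $n$ copies of $G$; $C_4$ is the 4-cycle and $K_{p,q}$ the complete bipartite graph. A component is trivial if it is isomorphic to $K_1$. A cluster is a disjoint union of complete graphs. For $s,k \in \mathbb{Z}_{\ge 0}\cup\{\infty\}$, an $(s,k)$-polar partition of $G$ is a partition $(A,B)$ of $V(G)$ (parts may be empty) such that $G[A]$ is a complete multipartite graph with at most $s$ parts and $G[B]$ is a cluster with at most $k$ components; $\infty$ means unbounded. $G$ is $(s,k)$-polar if it has such a partition. A cograph minimal $(s,k)$-polar obstruction is a cograph that is not $(s,k)$-polar but all of whose proper induced subgraphs are $(s,k)$-polar. Such an obstruction has type $(c,i)$ if it has exactly $c$ connected components, exactly $i$ of which are trivial. -}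

module Defs where

open import Data.Nat using (ℕ; zero; suc; _+_; _<_)
open import Data.Bool using (Bool; true; false; if_then_else_)
open import Data.Fin using (Fin; zero; suc; splitAt; toℕ)
open import Data.Sum using (_⊎_; inj₁; inj₂)
open import Data.Product using (Σ; ∃; _×_; _,_)
open import Relation.Binary.PropositionalEquality using (_≡_; _≢_; refl)
open import Relation.Nullary using (¬_)
open import Function.Bundles using (_⇔_; _↔_; Inverse)
open import Function.Definitions using (Injective)

record Graph : Set where
  field
    n     : ℕ
    adj   : Fin n → Fin n → Bool
    sym   : ∀ u v → adj u v ≡ adj v u
    irr   : ∀ u → adj u u ≡ false
open Graph public

Empty : ℕ → Graph
Empty p = record { n = p ; adj = λ _ _ → false ; sym = λ _ _ → refl ; irr = λ _ → refl }

K₁ : Graph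
K₁ = Empty 1

private
  sadj : (G H : Graph) → Bool → Fin (n G) ⊎ Fin (n H) → Fin (n G) ⊎ Fin (n H) → Bool
  sadj G H c (inj₁ a) (inj₁ b) = adj G a b
  sadj G H c (inj₂ a) (inj₂ b) = adj H a b
  sadj G H c (inj₁ a) (inj₂ b) = c
  sadj G H c (inj₂ a) (inj₁ b) = c

  ssym : ∀ G H c x y → sadj G H c x y ≡ sadj G H c y x
  ssym G H c (inj₁ a) (inj₁ b) = sym G a b
  ssym G H c (inj₂ a) (inj₂ b) = sym H a b
  ssym G H c (inj₁ a) (inj₂ b) = refl
  ssym G H c (inj₂ a) (inj₁ b) = refl

  sirr : ∀ G H c x → sadj G H c x x ≡ false
  sirr G H c (inj₁ a) = irr G a
  sirr G H c (inj₂ a) = irr H a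

combine : Bool → Graph → Graph → Graph
combine c G H = record
  { n = n G + n H
  ; adj = λ u v → sadj G H c (splitAt (n G) u) (splitAt (n G) v)
  ; sym = λ u v → ssym G H c (splitAt (n G) u) (splitAt (n G) v)
  ; irr = λ u → sirr G H c (splitAt (n G) u)
  }

infixl 6 _⊹_
_⊹_ : Graph → Graph → Graph
_⊹_ = combine false

infixl 7 _⊕_
_⊕_ : Graph → Graph → Graph
_⊕_ = combine true

copies : ℕ → Graph → Graph
copies zero    G = Empty 0
copies (suc m) G = G ⊹ copies m G

K[_,_] : ℕ → ℕ → Graph
K[ p , q ] = Empty p ⊕ Empty q

private
  c4 : Fin 4 → Fin 4 → Bool
  c4 zero (suc zero) = true
  c4 (suc zero) zero = true
  c4 (suc zero) (suc (suc zero)) = true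
  c4 (suc (suc zero)) (suc zero) = true
  c4 (suc (suc zero)) (suc (suc (suc zero))) = true
  c4 (suc (suc (suc zero))) (suc (suc zero)) = true
  c4 (suc (suc (suc zero))) zero = true
  c4 zero (suc (suc (suc zero))) = true
  c4 _ _ = false

  c4sym : ∀ u v → c4 u v ≡ c4 v u
  c4sym zero zero = refl
  c4sym zero (suc zero) = refl
  c4sym zero (suc (suc zero)) = refl
  c4sym zero (suc (suc (suc zero))) = refl
  c4sym (suc zero) zero = refl
  c4sym (suc zero) (suc zero) = refl
  c4sym (suc zero) (suc (suc zero)) = refl
  c4sym (suc zero) (suc (suc (suc zero))) = refl
  c4sym (suc (suc zero)) zero = refl
  c4sym (suc (suc zero)) (suc zero) = refl
  c4sym (suc (suc zero)) (suc (suc zero)) = refl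
  c4sym (suc (suc zero)) (suc (suc (suc zero))) = refl
  c4sym (suc (suc (suc zero))) zero = refl
  c4sym (suc (suc (suc zero))) (suc zero) = refl
  c4sym (suc (suc (suc zero))) (suc (suc zero)) = refl
  c4sym (suc (suc (suc zero))) (suc (suc (suc zero))) = refl

  c4irr : ∀ u → c4 u u ≡ false
  c4irr zero = refl
  c4irr (suc zero) = refl
  c4irr (suc (suc zero)) = refl
  c4irr (suc (suc (suc zero))) = refl

C₄ : Graph
C₄ = record { n = 4 ; adj = c4 ; sym = c4sym ; irr = c4irr }

P₄adj : Fin 4 → Fin 4 → Bool
P₄adj zero (suc zero) = true
P₄adj (suc zero) zero = true
P₄adj (suc zero) (suc (suc zero)) = true
P₄adj (suc (suc zero)) (suc zero) = true
P₄adj (suc (suc zero)) (suc (suc (suc zero))) = true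
P₄adj (suc (suc (suc zero))) (suc (suc zero)) = true
P₄adj _ _ = false

_≅_ : Graph → Graph → Set
G ≅ H = Σ (Fin (n G) ↔ Fin (n H)) λ f →
          ∀ u v → adj G u v ≡ adj H (Inverse.to f u) (Inverse.to f v)

induced : (G : Graph) {m : ℕ} → (Fin m → Fin (n G)) → Graph
induced G {m} f = record
  { n = m ; adj = λ u v → adj G (f u) (f v)
  ; sym = λ u v → sym G (f u) (f v) ; irr = λ u → irr G (f u) }

Cograph : Graph → Set
Cograph G = ¬ (Σ (Fin 4 → Fin (n G)) λ f → Injective _≡_ _≡_ f ×
                 (∀ i j → adj G (f i) (f j) ≡ P₄adj i j))

-- (∞,k)-polar partitions.
-- side v = true means v ∈ A, side v = false means v ∈ B.
-- G[A] complete multipartite (unboundedly many parts, labelled by ℕ):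
--   distinct u,v ∈ A are adjacent iff they lie in different parts.
-- G[B] a cluster with at most k components (cliques labelled by Fin k):
--   distinct u,v ∈ B are adjacent iff they lie in the same clique.
InfKPolar : ℕ → Graph → Set
InfKPolar k G =
  Σ (Fin (n G) → Bool) λ side →
  Σ (Fin (n G) → ℕ) λ part →
  Σ (Fin (n G) → Fin k) λ clique →
    ∀ u v → u ≢ v →
      (side u ≡ true → side v ≡ true → (adj G u v ≡ true ⇔ part u ≢ part v)) ×
      (side u ≡ false → side v ≡ false → (adj G u v ≡ true ⇔ clique u ≡ clique v))

CographMinObstruction : ℕ → Graph → Set
CographMinObstruction k G =
  Cograph G × ¬ InfKPolar k G ×
  (∀ (m : ℕ) (f : Fin m → Fin (n G)) → m < n G → Injective _≡_ _≡_ f →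
     InfKPolar k (induced G f))

data Reach (G : Graph) : Fin (n G) → Fin (n G) → Set where
  here : ∀ {u} → Reach G u u
  step : ∀ {u w v} → adj G u w ≡ true → Reach G w v → Reach G u v

countB : ∀ {m} → (Fin m → Bool) → ℕ
countB {zero}  p = 0
countB {suc m} p = (if p zero then 1 else 0) + countB (λ i → p (suc i))

_≡ᶠ_ : ∀ {m} → Fin m → Fin m → Bool
a ≡ᶠ b = toℕ a Data.Nat.≡ᵇ toℕ b

-- G has type (c,i): its vertices are labelled by exactly c connected
-- components (a surjective labelling whose fibres are the components),
-- and exactly i of these components have a single vertex (are ≅ K₁).
HasType : Graph → ℕ → ℕ → Set
HasType G c i =
  Σ (Fin (n G) → Fin c) λ comp →
    (∀ j → ∃ λ u → comp u ≡ j) ×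
    (∀ u v → (comp u ≡ comp v ⇔ Reach G u v)) ×
    countB (λ j → countB (λ u → comp u ≡ᶠ j) Data.Nat.≡ᵇ 1) ≡ i

-- A graph of type (k+2, k+1) is (k+1)K₁ + H with H connected. In a minimal
-- obstruction, delete one isolated vertex x and take a polar partition of the rest. If another
-- isolated vertex is on the multipartite side, x can join its part; so the other k isolated
-- vertices are k distinct cliques, H lies on the multipartite side and is complete multipartite.
-- If every part but that of some vertex were a singleton, G would be polar; hence H has two parts
-- with at least two vertices each. A third part gives an induced K₁ ⊕ C₄; with only two parts,
-- each has at least k+1 vertices (else G is polar), giving an induced K_{k+1,k+1}. Together with
-- the isolated vertices this subgraph is already not polar, so by minimality it is all of G.
-- Conversely, (k+1)K₁ + H is (∞,k)-polar iff H is (1,k)-polar, which fails for both graphs,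
-- while explicit partitions show that every vertex-deleted subgraph is polar.

module Submission where

open import Defs hiding (sym)
open import Data.Nat using (ℕ; _≤_; _+_)
open import Data.Product using (_×_)
open import Data.Sum using (_⊎_)
open import Function.Bundles using (_⇔_)

open import Data.Nat as ℕ using (zero; suc; _<_; _≟_; s≤s)
import Data.Nat.Properties as ℕₚ
open import Data.Bool as Bool using (Bool; true; false; not)
open import Data.Bool.Properties using (T-≡; ¬-not; ⇔→≡)
open import Data.Fin as Fin using (Fin; zero; suc; punchIn; punchOut; splitAt; #_)
import Data.Fin.Properties as Finₚ
open import Data.Vec.Functional using ([]; _∷_)
open import Data.Sum using (inj₁; inj₂; swap)
import Data.Sum.Properties as Sumₚ
open Sumₚ using (inj₁-injective; inj₂-injective)
open import Data.Sum.Function.Propositional using (_⊎-↔_)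
open import Data.Product using (Σ; ∃; ∃₂; _,_; proj₁; proj₂)
open import Data.Empty using (⊥; ⊥-elim)
open import Function using (_∘_; id)
open import Function.Bundles using (Inverse; Injection; _↔_; mk⇔; mk↔ₛ′; Equivalence)
open import Function.Definitions using (Injective)
open import Function.Properties.Inverse using (↔-refl; ↔-sym; ↔-trans; ↔⇒↣)
open import Relation.Binary.PropositionalEquality
open import Relation.Binary.Definitions using (DecidableEquality)
open import Relation.Nullary using (¬_; Dec; yes; no; does; ¬?; contradiction)
open import Relation.Nullary.Decidable using (decidable-stable; map′; _→-dec_; _×-dec_; toWitness; True)
open import Relation.Unary using (Decidable)

open Inverse using (to; from; strictlyInverseˡ; strictlyInverseʳ)
open Equivalence using () renaming (to to ⇒; from to ⇐)

Adj : Set → Set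
Adj V = V → V → Bool

record _⊑_ {V W : Set} (a : Adj V) (b : Adj W) : Set where
  constructor embedding
  field
    map       : V → W
    injective : Injective _≡_ _≡_ map
    adj-map   : ∀ u v → b (map u) (map v) ≡ a u v

⊑-trans : {U V W : Set} {a : Adj U} {b : Adj V} {c : Adj W} → a ⊑ b → b ⊑ c → a ⊑ c
⊑-trans (embedding f f-inj f-adj) (embedding g g-inj g-adj) =
  embedding (g ∘ f) (f-inj ∘ g-inj) λ u v → trans (g-adj (f u) (f v)) (f-adj u v)

record _≃_ {V W : Set} (a : Adj V) (b : Adj W) : Set where
  constructor iso
  field
    bijection : V ↔ W
    adj-to    : ∀ u v → a u v ≡ b (to bijection u) (to bijection v)

≅⇔≃ : ∀ {G H} → G ≅ H ⇔ adj G ≃ adj H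
≅⇔≃ = mk⇔ (λ (f , f-adj) → iso f f-adj) (λ (iso f f-adj) → f , f-adj)

≗⇒≃ : {V : Set} {a b : Adj V} → (∀ u v → a u v ≡ b u v) → a ≃ b
≗⇒≃ a≗b = iso ↔-refl a≗b

≃-sym : {V W : Set} {a : Adj V} {b : Adj W} → a ≃ b → b ≃ a
≃-sym {b = b} (iso f f-adj) = iso (↔-sym f) λ u v →
  sym (trans (f-adj (from f u) (from f v))
             (cong₂ b (strictlyInverseˡ f u) (strictlyInverseˡ f v)))

≃-trans : {U V W : Set} {a : Adj U} {b : Adj V} {c : Adj W} → a ≃ b → b ≃ c → a ≃ c
≃-trans (iso f f-adj) (iso g g-adj) = iso (↔-trans f g) λ u v → trans (f-adj u v) (g-adj (to f u) (to f v))

≃⇒⊑ : {V W : Set} {a : Adj V} {b : Adj W} → a ≃ b → a ⊑ b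
≃⇒⊑ (iso f f-adj) = embedding (to f) (Injection.injective (↔⇒↣ f)) λ u v → sym (f-adj u v)

surjective-⊑⇒≃ : {V W : Set} {a : Adj V} {b : Adj W} (e : a ⊑ b) →
                 (∀ w → ∃ λ v → _⊑_.map e v ≡ w) → b ≃ a
surjective-⊑⇒≃ {V} {W} {b = b} (embedding f f-inj f-adj) f-surj =
  iso (mk↔ₛ′ pre f (λ v → f-inj (proj₂ (f-surj (f v)))) (λ w → proj₂ (f-surj w)))
      λ u v → trans (sym (cong₂ b (proj₂ (f-surj u)) (proj₂ (f-surj v)))) (f-adj (pre u) (pre v))
  where
  pre : W → V
  pre w = proj₁ (f-surj w)

data Reachable {V : Set} (a : Adj V) : V → V → Set where
  here : ∀ {u} → Reachable a u u
  step : ∀ {u w v} → a u w ≡ true → Reachable a w v → Reachable a u v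

Reach⇔Reachable : ∀ {G u v} → Reach G u v ⇔ Reachable (adj G) u v
Reach⇔Reachable = mk⇔ forth back
  where
  forth : ∀ {G u v} → Reach G u v → Reachable (adj G) u v
  forth here       = here
  forth (step e r) = step e (forth r)
  back : ∀ {G u v} → Reachable (adj G) u v → Reach G u v
  back here       = here
  back (step e r) = step e (back r)

Reachable-map : {V W : Set} {a : Adj V} {b : Adj W} (f : V → W) →
                (∀ u v → a u v ≡ true → b (f u) (f v) ≡ true) →
                ∀ {u v} → Reachable a u v → Reachable b (f u) (f v)
Reachable-map f f-edge here       = here
Reachable-map f f-edge (step e r) = step (f-edge _ _ e) (Reachable-map f f-edge r)

Reachable-≃ : ∀ {V W} {a : Adj V} {b : Adj W} (e : a ≃ b) → let f = _≃_.bijection e in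
              ∀ {x y} → Reachable a x y ⇔ Reachable b (to f x) (to f y)
Reachable-≃ {a = a} {b} (iso f f-adj) {x} {y} = mk⇔
  (Reachable-map (to f) λ u v e → trans (sym (f-adj u v)) e)
  (subst₂ (Reachable a) (strictlyInverseʳ f x) (strictlyInverseʳ f y) ∘
     Reachable-map (from f) λ u v e → trans (sym (_≃_.adj-to (≃-sym (iso f f-adj)) u v)) e)

P₄-free : {V : Set} → Adj V → Set
P₄-free a = ¬ (P₄adj ⊑ a)

P₄-free-⊑ : {V W : Set} {a : Adj V} {b : Adj W} → a ⊑ b → P₄-free b → P₄-free a
P₄-free-⊑ a⊑b b-free P₄⊑a = b-free (⊑-trans P₄⊑a a⊑b)

missing⇒< : ∀ {m N} {f : Fin m → Fin N} {v : Fin N} → Injective _≡_ _≡_ f → (∀ i → f i ≢ v) → m < N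
missing⇒< {N = suc N} {f} {v} f-inj f≢v = s≤s (Finₚ.injective⇒≤ punchOut-f-inj)
  where
  punchOut-f-inj : Injective _≡_ _≡_ (λ i → punchOut (f≢v i ∘ sym))
  punchOut-f-inj {i} {j} e = f-inj (Finₚ.punchOut-injective (f≢v i ∘ sym) (f≢v j ∘ sym) e)

<⇒missing : ∀ {m N} {f : Fin m → Fin N} → m < N → Injective _≡_ _≡_ f → ∃ λ v → ∀ i → f i ≢ v
<⇒missing {m} {N} {f} m<N f-inj with Finₚ.all? (λ v → Finₚ.any? (λ i → f i Fin.≟ v))
... | yes f-surj = ⊥-elim (Finₚ.<⇒notInjective m<N preimage-injective)
  where
  preimage-injective : Injective _≡_ _≡_ (λ v → proj₁ (f-surj v))
  preimage-injective {v} {w} e = trans (sym (proj₂ (f-surj v))) (trans (cong f e) (proj₂ (f-surj w)))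
... | no ¬f-surj with Finₚ.¬∀⟶∃¬ N _ (λ v → Finₚ.any? (λ i → f i Fin.≟ v)) ¬f-surj
...   | v , ¬hit = v , λ i e → ¬hit (i , e)

injective-≮⇒surjective : ∀ {m N} {f : Fin m → Fin N} → Injective _≡_ _≡_ f → ¬ m < N →
                          ∀ v → ∃ λ i → f i ≡ v
injective-≮⇒surjective {f = f} f-inj m≮N v with Finₚ.any? (λ i → f i Fin.≟ v)
... | yes hit  = hit
... | no ¬hit = contradiction (missing⇒< f-inj (λ i e → ¬hit (i , e))) m≮N

choose-or-label : ∀ {n} {P : Fin n → Set} → Decidable P → ∀ m →
  (Σ (Fin (suc m) → Fin n) λ g → Injective _≡_ _≡_ g × ∀ i → P (g i)) ⊎
  (Σ (∀ u → P u → Fin m) λ f → ∀ {u v} pu pv → f u pu ≡ f v pv → u ≡ v)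
choose-or-label {zero}  P? m = inj₂ ((λ ()) , λ {u} → ⊥-elim (Finₚ.¬Fin0 u))
choose-or-label {suc n} {P} P? m with P? zero
choose-or-label {suc n} {P} P? m | no ¬P₀ with choose-or-label (P? ∘ suc) m
...   | inj₁ (g , g-inj , Pg) = inj₁ (suc ∘ g , g-inj ∘ Finₚ.suc-injective , Pg)
...   | inj₂ (f , f-inj)      = inj₂ (f′ , f′-inj)
  where
  f′ : ∀ u → P u → Fin m
  f′ zero    P₀ = contradiction P₀ ¬P₀
  f′ (suc u) Pu = f u Pu
  f′-inj : ∀ {u v} pu pv → f′ u pu ≡ f′ v pv → u ≡ v
  f′-inj {zero}  P₀ _ _ = contradiction P₀ ¬P₀
  f′-inj {suc _} {zero} _ P₀ _ = contradiction P₀ ¬P₀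
  f′-inj {suc _} {suc _} pu pv e = cong suc (f-inj pu pv e)
choose-or-label {suc n} {P} P? zero | yes P₀ = inj₁ ((λ _ → zero) , (λ { {zero} {zero} _ → refl }) , λ _ → P₀)
choose-or-label {suc n} {P} P? (suc m′) | yes P₀ with choose-or-label (P? ∘ suc) m′
... | inj₁ (g , g-inj , Pg) = inj₁ (zero ∷ suc ∘ g , g′-inj , λ { zero → P₀ ; (suc i) → Pg i })
  where
  g′-inj : Injective _≡_ _≡_ (zero ∷ suc ∘ g)
  g′-inj {zero}  {zero}  _ = refl
  g′-inj {suc i} {suc j} e = cong suc (g-inj (Finₚ.suc-injective e))
... | inj₂ (f , f-inj) = inj₂ (f′ , f′-inj)
  where
  f′ : ∀ u → P u → Fin (suc m′)
  f′ zero    _  = zero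
  f′ (suc u) Pu = suc (f u Pu)
  f′-inj : ∀ {u v} pu pv → f′ u pu ≡ f′ v pv → u ≡ v
  f′-inj {zero}  {zero}  _  _  _ = refl
  f′-inj {suc _} {suc _} pu pv e = cong suc (f-inj pu pv (Finₚ.suc-injective e))

countB≤ : ∀ {m} (p : Fin m → Bool) → countB p ≤ m
countB≤ {zero}  p = ℕ.z≤n
countB≤ {suc m} p with p zero
... | true  = s≤s (countB≤ (p ∘ suc))
... | false = ℕₚ.m≤n⇒m≤1+n (countB≤ (p ∘ suc))

countB≡0⇔ : ∀ {m} (p : Fin m → Bool) → countB p ≡ 0 ⇔ (∀ w → p w ≡ false)
countB≡0⇔ p = mk⇔ (forth p) (back p)
  where
  forth : ∀ {m} (p : Fin m → Bool) → countB p ≡ 0 → ∀ w → p w ≡ false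
  forth {suc m} p c w with p zero in e
  forth p c zero    | false = e
  forth p c (suc w) | false = forth (p ∘ suc) c w
  back : ∀ {m} (p : Fin m → Bool) → (∀ w → p w ≡ false) → countB p ≡ 0
  back {zero}  p all-false = refl
  back {suc m} p all-false rewrite all-false zero = back (p ∘ suc) (all-false ∘ suc)

countB≡m⇔ : ∀ {m} (p : Fin m → Bool) → countB p ≡ m ⇔ (∀ w → p w ≡ true)
countB≡m⇔ p = mk⇔ (forth p) (back p)
  where
  forth : ∀ {m} (p : Fin m → Bool) → countB p ≡ m → ∀ w → p w ≡ true
  forth {suc m} p c w with p zero in e
  forth p c zero    | true  = e
  forth p c (suc w) | true  = forth (p ∘ suc) (ℕₚ.suc-injective c) w
  forth p c w       | false = contradiction c (ℕₚ.<⇒≢ (s≤s (countB≤ (p ∘ suc))))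
  back : ∀ {m} (p : Fin m → Bool) → (∀ w → p w ≡ true) → countB p ≡ m
  back {zero}  p all-true = refl
  back {suc m} p all-true rewrite all-true zero = cong suc (back (p ∘ suc) (all-true ∘ suc))

countB≡1⇒unique : ∀ {m} (p : Fin m → Bool) → countB p ≡ 1 →
                  ∀ {x y} → p x ≡ true → p y ≡ true → x ≡ y
countB≡1⇒unique {suc m} p c {x} {y} px py with p zero in e
... | true  = unique x px y py
  where
  rest-false : ∀ w → p (suc w) ≡ false
  rest-false = ⇒ (countB≡0⇔ (p ∘ suc)) (ℕₚ.suc-injective c)
  unique : ∀ x → p x ≡ true → ∀ y → p y ≡ true → x ≡ y
  unique zero    _  zero    _  = refl
  unique (suc x) px _       _  = contradiction (trans (sym px) (rest-false x)) λ ()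
  unique zero    _  (suc y) py = contradiction (trans (sym py) (rest-false y)) λ ()
... | false = unique x px y py
  where
  unique : ∀ x → p x ≡ true → ∀ y → p y ≡ true → x ≡ y
  unique zero    px _       _  = contradiction (trans (sym px) e) λ ()
  unique (suc x) _  zero    py = contradiction (trans (sym py) e) λ ()
  unique (suc x) px (suc y) py = cong suc (countB≡1⇒unique (p ∘ suc) c px py)

unique⇒countB≡1 : ∀ {m} (p : Fin m → Bool) {u} → p u ≡ true → (∀ w → p w ≡ true → w ≡ u) →
                  countB p ≡ 1
unique⇒countB≡1 {suc m} p {zero} pu only-u rewrite pu =
  cong suc (⇐ (countB≡0⇔ (p ∘ suc)) λ w → ¬-not (λ pw → contradiction (only-u (suc w) pw) λ ()))
unique⇒countB≡1 p {suc u} pu only-u with p zero in e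
... | true  = contradiction (only-u zero e) λ ()
... | false = unique⇒countB≡1 (p ∘ suc) pu (λ w pw → Finₚ.suc-injective (only-u (suc w) pw))

OneFalse : ∀ {m} → (Fin m → Bool) → Set
OneFalse q = ∃ λ j₀ → q j₀ ≡ false × ∀ j → j ≢ j₀ → q j ≡ true

countB≡m⇔one-false : ∀ {m} (q : Fin (suc m) → Bool) → countB q ≡ m ⇔ OneFalse q
countB≡m⇔one-false q = mk⇔ (forth q) (back q)
  where
  forth : ∀ {m} (q : Fin (suc m) → Bool) → countB q ≡ m → OneFalse q
  forth {m} q c with q zero in e
  forth {zero}  q () | true
  forth {suc m} q c  | true with forth (q ∘ suc) (ℕₚ.suc-injective c)
  ... | j₀ , qj₀ , others = suc j₀ , qj₀ , λ { zero _ → e ; (suc j) j≢ → others j (j≢ ∘ cong suc) }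
  forth {m} q c | false = zero , e , λ { zero 0≢0 → contradiction refl 0≢0
                                       ; (suc j) _ → ⇒ (countB≡m⇔ (q ∘ suc)) c j }
  back : ∀ {m} (q : Fin (suc m) → Bool) → OneFalse q → countB q ≡ m
  back q (zero , q₀ , others) rewrite q₀ = ⇐ (countB≡m⇔ (q ∘ suc)) (λ j → others (suc j) λ ())
  back {suc m} q (suc j₀ , qj₀ , others) rewrite others zero (λ ()) =
    cong suc (back (q ∘ suc) (j₀ , qj₀ , λ j j≢ → others (suc j) (j≢ ∘ Finₚ.suc-injective)))

≡ᶠ⇔≡ : ∀ {m} {i j : Fin m} → (i ≡ᶠ j) ≡ true ⇔ i ≡ j
≡ᶠ⇔≡ {i = i} {j} = mk⇔ (λ e → Finₚ.toℕ-injective (ℕₚ.≡ᵇ⇒≡ _ _ (⇐ T-≡ e)))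
                       (λ i≡j → ⇒ T-≡ (ℕₚ.≡⇒≡ᵇ _ _ (cong Fin.toℕ i≡j)))

≡ᵇ⇔≡ : ∀ {m n} → (m ℕ.≡ᵇ n) ≡ true ⇔ m ≡ n
≡ᵇ⇔≡ {m} {n} = mk⇔ (ℕₚ.≡ᵇ⇒≡ m n ∘ ⇐ T-≡) (⇒ T-≡ ∘ ℕₚ.≡⇒≡ᵇ m n)

all-trivial-but-one : ∀ {G c} ((comp , _) : HasType G (suc c) c) →
  ∃ λ j₀ → ∀ j → j ≢ j₀ → ∀ {x y} → comp x ≡ j → comp y ≡ j → x ≡ y
all-trivial-but-one (comp , _ , _ , count) with ⇒ (countB≡m⇔one-false _) count
... | j₀ , _ , trivial = j₀ , λ j j≢j₀ cx cy →
  countB≡1⇒unique _ (⇒ ≡ᵇ⇔≡ (trivial j j≢j₀)) (⇐ ≡ᶠ⇔≡ cx) (⇐ ≡ᶠ⇔≡ cy)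

edgeless : {V : Set} → Adj V
edgeless _ _ = false

combineAdj : {A B : Set} → Bool → Adj A → Adj B → Adj (A ⊎ B)
combineAdj c a b (inj₁ x) (inj₁ y) = a x y
combineAdj c a b (inj₂ x) (inj₂ y) = b x y
combineAdj c a b (inj₁ x) (inj₂ y) = c
combineAdj c a b (inj₂ x) (inj₁ y) = c

combine≃ : ∀ c G H → adj (combine c G H) ≃ combineAdj c (adj G) (adj H)
combine≃ c G H = iso Finₚ.+↔⊎ adj-split
  where
  adj-split : ∀ u v → adj (combine c G H) u v ≡
                      combineAdj c (adj G) (adj H) (splitAt (n G) u) (splitAt (n G) v)
  adj-split u v with splitAt (n G) u | splitAt (n G) v
  ... | inj₁ _ | inj₁ _ = refl
  ... | inj₁ _ | inj₂ _ = refl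
  ... | inj₂ _ | inj₁ _ = refl
  ... | inj₂ _ | inj₂ _ = refl

combine-≃ : {A A′ B B′ : Set} {a : Adj A} {a′ : Adj A′} {b : Adj B} {b′ : Adj B′} →
            ∀ c → a ≃ a′ → b ≃ b′ → combineAdj c a b ≃ combineAdj c a′ b′
combine-≃ c (iso f f-adj) (iso g g-adj) = iso (f ⊎-↔ g) λ
  { (inj₁ x) (inj₁ y) → f-adj x y
  ; (inj₁ x) (inj₂ y) → refl
  ; (inj₂ x) (inj₁ y) → refl
  ; (inj₂ x) (inj₂ y) → g-adj x y }

copies-edgeless : ∀ m → adj (copies m K₁) ≃ edgeless {Fin m}
copies-edgeless m = iso (subst (λ l → Fin (n (copies m K₁)) ↔ Fin l) (size m) ↔-refl) (no-edge m)
  where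
  size : ∀ m → n (copies m K₁) ≡ m
  size zero    = refl
  size (suc m) = cong suc (size m)
  no-edge : ∀ m u v → adj (copies m K₁) u v ≡ false
  no-edge (suc m) u v with splitAt 1 u | splitAt 1 v
  ... | inj₁ zero | inj₁ zero = refl
  ... | inj₁ _    | inj₂ _    = refl
  ... | inj₂ _    | inj₁ _    = refl
  ... | inj₂ u′   | inj₂ v′   = no-edge m u′ v′

withIsolated : (m : ℕ) {W : Set} → Adj W → Adj (Fin m ⊎ W)
withIsolated m b = combineAdj false edgeless b

copies-K₁⊹≃ : ∀ m H {W} {b : Adj W} → adj H ≃ b → adj (copies m K₁ ⊹ H) ≃ withIsolated m b
copies-K₁⊹≃ m H H≃b = ≃-trans (combine≃ false (copies m K₁) H) (combine-≃ false (copies-edgeless m) H≃b)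

multipartite : ∀ {r} {W : Set} → (W → Fin r) → Adj W
multipartite cl x y = not (cl x ≡ᶠ cl y)

multipartite⇔ : ∀ {r W} (cl : W → Fin r) x y → multipartite cl x y ≡ true ⇔ cl x ≢ cl y
multipartite⇔ cl x y with cl x ≡ᶠ cl y in eq
... | true  = mk⇔ (λ ()) (λ ne → contradiction (⇒ ≡ᶠ⇔≡ eq) ne)
... | false = mk⇔ (λ _ e → contradiction (trans (sym (⇐ ≡ᶠ⇔≡ e)) eq) λ ()) (λ _ → refl)

multipartite-connected : ∀ {r W} (cl : W → Fin r) → (∀ x → ∃ λ y → cl y ≢ cl x) →
                         ∀ x y → Reachable (multipartite cl) x y
multipartite-connected cl other x y with cl x Fin.≟ cl y | other x
... | no x≢y | _       = step (⇐ (multipartite⇔ cl x y) x≢y) here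
... | yes x≡y | z , z≢x = step (⇐ (multipartite⇔ cl x z) (≢-sym z≢x))
                              (step (⇐ (multipartite⇔ cl z y) (λ z≡y → z≢x (trans z≡y (sym x≡y)))) here)

-- Polar partitions

-- The condition InfKPolar imposes on two vertices, so that Polar k (adj G) unfolds to InfKPolar k G.
Compatible : ∀ {k} → Bool → Bool → Bool → ℕ → ℕ → Fin k → Fin k → Set
Compatible e s₁ s₂ p₁ p₂ c₁ c₂ =
  (s₁ ≡ true  → s₂ ≡ true  → (e ≡ true ⇔ p₁ ≢ p₂)) ×
  (s₁ ≡ false → s₂ ≡ false → (e ≡ true ⇔ c₁ ≡ c₂))

Compatible-resp : ∀ {k e e′ s₁ s₂ p₁ p₂} {c₁ c₂ : Fin k} → e ≡ e′ →
                  Compatible e s₁ s₂ p₁ p₂ c₁ c₂ → Compatible e′ s₁ s₂ p₁ p₂ c₁ c₂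
Compatible-resp refl c = c

PolarPair : ∀ {k} {V : Set} → Adj V → (V → Bool) → (V → ℕ) → (V → Fin k) → V → V → Set
PolarPair a side part clique u v =
  Compatible (a u v) (side u) (side v) (part u) (part v) (clique u) (clique v)

Polar : ℕ → {V : Set} → Adj V → Set
Polar k {V} a = Σ (V → Bool) λ side → Σ (V → ℕ) λ part → Σ (V → Fin k) λ clique →
  ∀ u v → u ≢ v → PolarPair a side part clique u v

PolarAvoiding : ℕ → {V : Set} → Adj V → V → Set
PolarAvoiding k {V} a x = Σ (V → Bool) λ side → Σ (V → ℕ) λ part → Σ (V → Fin k) λ clique →
  ∀ u v → u ≢ v → u ≢ x → v ≢ x → PolarPair a side part clique u v

-- (1,k)-polar: the multipartite side is a single part, i.e. an independent set.
Polar₁ : ℕ → {V : Set} → Adj V → Set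
Polar₁ k {V} a = Σ (V → Bool) λ side → Σ (V → Fin k) λ clique →
  ∀ u v → u ≢ v → PolarPair a side (λ _ → 0) clique u v

Polar₁Avoiding : ℕ → {V : Set} → Adj V → V → Set
Polar₁Avoiding k {V} a x = Σ (V → Bool) λ side → Σ (V → Fin k) λ clique →
  ∀ u v → u ≢ v → u ≢ x → v ≢ x → PolarPair a side (λ _ → 0) clique u v

PolarBelow : ℕ → {N : ℕ} → Adj (Fin N) → Set
PolarBelow k {N} a = ∀ m (f : Fin m → Fin N) → m < N → Injective _≡_ _≡_ f → Polar k (λ i j → a (f i) (f j))

non-edge-same-part : ∀ {e : Bool} {p p′ : ℕ} → e ≡ false → p ≡ p′ → (e ≡ true ⇔ p ≢ p′)
non-edge-same-part e≡false p≡p′ =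
  mk⇔ (λ e≡true → contradiction (trans (sym e≡true) e≡false) λ ()) (λ p≢p′ → contradiction p≡p′ p≢p′)

Polar-from-split : ∀ {k V} {a : Adj V} {InB : V → Set} → Decidable InB → (clique : V → Fin k) →
  (∀ u v → u ≢ v → ¬ InB u → ¬ InB v → a u v ≡ false) →
  (∀ u v → u ≢ v → InB u → InB v → (a u v ≡ true ⇔ clique u ≡ clique v)) → Polar k a
Polar-from-split {V = V} {a} InB? clique independent cluster = side , (λ _ → 0) , clique , ok
  where
  side : V → Bool
  side u = not (does (InB? u))
  ok : ∀ u v → u ≢ v → PolarPair a side (λ _ → 0) clique u v
  ok u v u≢v with InB? u | InB? v
  ... | no u∉B  | no v∉B  = (λ _ _ → non-edge-same-part (independent u v u≢v u∉B v∉B) refl) , λ ()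
  ... | yes u∈B | yes v∈B = (λ ()) , λ _ _ → cluster u v u≢v u∈B v∈B
  ... | yes _   | no _    = (λ ()) , λ _ ()
  ... | no _    | yes _   = (λ _ ()) , λ ()

module _ {k : ℕ} {V : Set} {side : V → Bool} {part : V → ℕ} {clique : V → Fin k} where

  independent-in-cluster : ∀ {a : Adj V} (g : Fin (suc k) → V) →
    (∀ i j → i ≢ j → PolarPair a side part clique (g i) (g j)) →
    (∀ i → side (g i) ≡ false) → (∀ i j → i ≢ j → a (g i) (g j) ≡ false) → ⊥
  independent-in-cluster g ok in-B independent = Finₚ.<⇒notInjective (ℕₚ.n<1+n k) clique-g-inj
    where
    clique-g-inj : Injective _≡_ _≡_ (clique ∘ g)
    clique-g-inj {i} {j} e with i Fin.≟ j
    ... | yes i≡j = i≡j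
    ... | no  i≢j = contradiction (trans (sym (⇐ (proj₂ (ok i j i≢j) (in-B i) (in-B j)) e)) (independent i j i≢j))
                                  λ ()

  no-induced-P₃-in-cluster : ∀ {a : Adj V} {x y z} →
    PolarPair a side part clique x y → PolarPair a side part clique y z → PolarPair a side part clique x z →
    side x ≡ false → side y ≡ false → side z ≡ false →
    a x y ≡ true → a y z ≡ true → a x z ≡ false → ⊥
  no-induced-P₃-in-cluster xy yz xz x∈B y∈B z∈B exy eyz exz =
    contradiction (trans (sym (⇐ (proj₂ xz x∈B z∈B)
                                 (trans (⇒ (proj₂ xy x∈B y∈B) exy) (⇒ (proj₂ yz y∈B z∈B) eyz))))
                         exz)
                  λ ()

Polar-⊑ : ∀ {k} {V W : Set} {a : Adj V} {b : Adj W} → a ⊑ b → Polar k b → Polar k a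
Polar-⊑ (embedding f f-inj f-adj) (side , part , clique , ok) =
  side ∘ f , part ∘ f , clique ∘ f ,
  λ u v u≢v → Compatible-resp (f-adj u v) (ok (f u) (f v) (u≢v ∘ f-inj))

PolarAvoiding-⊑ : ∀ {k} {V W : Set} {a : Adj V} {b : Adj W} {x} → (e : a ⊑ b) → (∀ u → _⊑_.map e u ≢ x) →
                  PolarAvoiding k b x → Polar k a
PolarAvoiding-⊑ (embedding f f-inj f-adj) f≢x (side , part , clique , ok) =
  side ∘ f , part ∘ f , clique ∘ f ,
  λ u v u≢v → Compatible-resp (f-adj u v) (ok (f u) (f v) (u≢v ∘ f-inj) (f≢x u) (f≢x v))

PolarBelow⇒PolarAvoiding : ∀ {k N} {a : Adj (Fin N)} → Fin k → PolarBelow k a → ∀ x → PolarAvoiding k a x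
PolarBelow⇒PolarAvoiding {k} {suc N} {a} c₀ below x
  with below N (punchIn x) (ℕₚ.n<1+n N) (Finₚ.punchIn-injective x _ _)
... | side , part , clique , ok = lift true side , lift 0 part , lift c₀ clique , lifted-ok
  where
  lift : {A : Set} → A → (Fin N → A) → Fin (suc N) → A
  lift d L u with u Fin.≟ x
  ... | yes _   = d
  ... | no u≢x = L (punchOut (u≢x ∘ sym))

  lifted-ok : ∀ u v → u ≢ v → u ≢ x → v ≢ x →
              PolarPair a (lift true side) (lift 0 part) (lift c₀ clique) u v
  lifted-ok u v u≢v u≢x v≢x with u Fin.≟ x | v Fin.≟ x
  ... | yes u≡x | _        = contradiction u≡x u≢x
  ... | no _    | yes v≡x = contradiction v≡x v≢x
  ... | no p    | no q     =
    Compatible-resp (cong₂ a (Finₚ.punchIn-punchOut _) (Finₚ.punchIn-punchOut _))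
      (ok _ _ λ e → u≢v (trans (sym (Finₚ.punchIn-punchOut (p ∘ sym)))
                              (trans (cong (punchIn x) e) (Finₚ.punchIn-punchOut (q ∘ sym)))))

PolarAvoiding⇒PolarBelow : ∀ {k N} {V : Set} {a : Adj (Fin N)} {b : Adj V} →
                           a ⊑ b → (∀ w → PolarAvoiding k b w) → PolarBelow k a
PolarAvoiding⇒PolarBelow {a = a} (embedding g g-inj g-adj) avoiding m f m<N f-inj
  with <⇒missing m<N f-inj
... | v , f≢v = PolarAvoiding-⊑ (embedding (g ∘ f) (f-inj ∘ g-inj) λ i j → g-adj (f i) (f j))
                  (λ i → f≢v i ∘ g-inj) (avoiding (g v))

PolarBelow-⊑⇒≃ : ∀ {k N M} {a : Adj (Fin N)} {b : Adj (Fin M)} →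
                 PolarBelow k a → ¬ Polar k b → b ⊑ a → a ≃ b
PolarBelow-⊑⇒≃ {N = N} {M} {a} {b} below b-nonpolar (embedding ψ ψ-inj ψ-adj) =
  surjective-⊑⇒≃ (embedding ψ ψ-inj ψ-adj) (injective-≮⇒surjective ψ-inj M≮N)
  where
  M≮N : ¬ M < N
  M≮N M<N = b-nonpolar (Polar-⊑ (embedding {b = λ i j → a (ψ i) (ψ j)} id id ψ-adj) (below _ ψ M<N ψ-inj))

Polar-false-twin : ∀ {k} (G : Graph) {x w : Fin (n G)} → x ≢ w → (∀ v → adj G x v ≡ adj G w v) →
                   ((side , _) : PolarAvoiding k (adj G) x) → side w ≡ true → Polar k (adj G)
Polar-false-twin {k} G {x} {w} x≢w twin (side , part , clique , ok) w∈A =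
  at-x true side , at-x (part w) part , clique , ok′
  where
  at-x : {A : Set} → A → (Fin (n G) → A) → Fin (n G) → A
  at-x d L u with u Fin.≟ x
  ... | yes _ = d
  ... | no _  = L u

  as-w : ∀ v → v ≢ x → side v ≡ true → (adj G x v ≡ true ⇔ part w ≢ part v)
  as-w v v≢x v∈A with v Fin.≟ w
  ... | yes refl = mk⇔ (λ e → contradiction (trans (sym e) (trans (twin v) (irr G v))) λ ())
                       (λ ne → contradiction refl ne)
  ... | no v≢w   = subst (λ t → t ≡ true ⇔ _) (sym (twin v))
                         (proj₁ (ok w v (v≢w ∘ sym) (x≢w ∘ sym) v≢x) w∈A v∈A)

  ok′ : ∀ u v → u ≢ v → PolarPair (adj G) (at-x true side) (at-x (part w) part) clique u v
  ok′ u v u≢v with u Fin.≟ x | v Fin.≟ x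
  ... | yes u≡x | yes v≡x = contradiction (trans u≡x (sym v≡x)) u≢v
  ... | yes refl | no v≢x = (λ _ v∈A → as-w v v≢x v∈A) , λ ()
  ... | no u≢x | yes refl =
    (λ u∈A _ → subst (λ t → t ≡ true ⇔ _) (Graph.sym G x u)
                 (mk⇔ (≢-sym ∘ ⇒ (as-w u u≢x u∈A)) (⇐ (as-w u u≢x u∈A) ∘ ≢-sym))) ,
    λ _ ()
  ... | no u≢x | no v≢x = ok u v u≢v u≢x v≢x

infix 3 _⇔-dec_
_⇔-dec_ : ∀ {A B : Set} → Dec A → Dec B → Dec (A ⇔ B)
a? ⇔-dec b? = map′ (λ (f , g) → mk⇔ f g) (λ e → ⇒ e , ⇐ e) ((a? →-dec b?) ×-dec (b? →-dec a?))

module _ {k N : ℕ} (a : Adj (Fin N)) (side : Fin N → Bool) (clique : Fin N → Fin k) where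

  Polar₁Avoiding? : ∀ w → Dec (∀ u v → u ≢ v → u ≢ w → v ≢ w → PolarPair a side (λ _ → 0) clique u v)
  Polar₁Avoiding? w = Finₚ.all? λ u → Finₚ.all? λ v →
    ¬? (u Fin.≟ v) →-dec ¬? (u Fin.≟ w) →-dec ¬? (v Fin.≟ w) →-dec
      ((side u Bool.≟ true)  →-dec (side v Bool.≟ true)  →-dec (a u v Bool.≟ true ⇔-dec ¬? (0 ≟ 0))) ×-dec
      ((side u Bool.≟ false) →-dec (side v Bool.≟ false) →-dec (a u v Bool.≟ true ⇔-dec clique u Fin.≟ clique v))

Polar₁Avoiding-by-decision : ∀ {k N} (a : Adj (Fin N)) (side : Fin N → Bool) (clique : Fin N → Fin k) w →
  True (Polar₁Avoiding? a side clique w) → Polar₁Avoiding k a w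
Polar₁Avoiding-by-decision a side clique w ok = side , clique , toWitness ok

-- Isolated vertices beside a complete multipartite graph

-- The k+1 isolated vertices cannot all be singleton cliques, and any of them on the multipartite
-- side shares its part with every other vertex there.
withIsolated-Polar⇒Polar₁ : ∀ {k W} (b : Adj W) → Polar k (withIsolated (suc k) b) → Polar₁ k b
withIsolated-Polar⇒Polar₁ {k} {W} b (side , part , clique , ok)
  with Finₚ.any? (λ i → side (inj₁ i) Bool.≟ true)
... | no none-in-A = ⊥-elim (independent-in-cluster {side = side} {part} {clique} {withIsolated (suc k) b} inj₁
        (λ i j i≢j → ok _ _ (i≢j ∘ inj₁-injective)) (λ i → ¬-not (none-in-A ∘ (i ,_))) (λ _ _ _ → refl))
... | yes (i₀ , i₀∈A) = side ∘ inj₂ , clique ∘ inj₂ , ok′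
  where
  part-i₀ : ∀ x → side (inj₂ x) ≡ true → part (inj₂ x) ≡ part (inj₁ i₀)
  part-i₀ x x∈A = decidable-stable (_ ≟ _) λ ne →
    contradiction (⇐ (proj₁ (ok (inj₂ x) (inj₁ i₀) λ ()) x∈A i₀∈A) ne) λ ()
  ok′ : ∀ x y → x ≢ y → PolarPair b (side ∘ inj₂) (λ _ → 0) (clique ∘ inj₂) x y
  ok′ x y x≢y =
    (λ x∈A y∈A → non-edge-same-part
       (¬-not λ e → ⇒ (proj₁ (ok (inj₂ x) (inj₂ y) (x≢y ∘ inj₂-injective)) x∈A y∈A) e
                       (trans (part-i₀ x x∈A) (sym (part-i₀ y y∈A))))
       refl) ,
    proj₂ (ok (inj₂ x) (inj₂ y) (x≢y ∘ inj₂-injective))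

withIsolated-not-Polar : ∀ {k V W} {a : Adj V} {b : Adj W} → ¬ Polar₁ k b → a ≃ withIsolated (suc k) b →
                         ¬ Polar k a
withIsolated-not-Polar {b = b} ¬polar₁ a≃ =
  ¬polar₁ ∘ withIsolated-Polar⇒Polar₁ b ∘ Polar-⊑ (≃⇒⊑ (≃-sym a≃))

relabel-without : ∀ {k} → Fin k → Fin (suc k) → Fin (suc k) → Fin k
relabel-without c₀ i j with j Fin.≟ i
... | yes _  = c₀
... | no j≢i = punchOut (j≢i ∘ sym)

relabel-without-injective : ∀ {k} (c₀ : Fin k) {i j j′} → j ≢ i → j′ ≢ i →
                            relabel-without c₀ i j ≡ relabel-without c₀ i j′ → j ≡ j′
relabel-without-injective c₀ {i} {j} {j′} j≢i j′≢i e with j Fin.≟ i | j′ Fin.≟ i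
... | yes j≡i | _        = contradiction j≡i j≢i
... | no _    | yes j′≡i = contradiction j′≡i j′≢i
... | no p    | no q     = Finₚ.punchOut-injective (p ∘ sym) (q ∘ sym) e

withIsolated-PolarAvoiding : ∀ {k W} {b : Adj W} (cl : W → ℕ) → Fin k →
  (∀ x y → x ≢ y → (b x y ≡ true ⇔ cl x ≢ cl y)) → (∀ w → Polar₁Avoiding k b w) →
  ∀ v → PolarAvoiding k (withIsolated (suc k) b) v
withIsolated-PolarAvoiding {k} {W} {b} cl c₀ b-multipartite b-avoiding (inj₁ i) =
  side , part , clique , ok
  where
  side : Fin (suc k) ⊎ W → Bool
  side (inj₁ _) = false
  side (inj₂ _) = true
  part : Fin (suc k) ⊎ W → ℕ
  part (inj₁ _) = 0
  part (inj₂ x) = cl x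
  clique : Fin (suc k) ⊎ W → Fin k
  clique (inj₁ j) = relabel-without c₀ i j
  clique (inj₂ _) = c₀
  ok : ∀ u v → u ≢ v → u ≢ inj₁ i → v ≢ inj₁ i → PolarPair (withIsolated (suc k) b) side part clique u v
  ok (inj₁ j) (inj₁ j′) j≢j′ j≢i j′≢i = (λ ()) , λ _ _ →
    mk⇔ (λ ()) λ e →
      contradiction (cong inj₁ (relabel-without-injective c₀ (j≢i ∘ cong inj₁) (j′≢i ∘ cong inj₁) e)) j≢j′
  ok (inj₁ _) (inj₂ _) _ _ _ = (λ ()) , λ _ ()
  ok (inj₂ _) (inj₁ _) _ _ _ = (λ _ ()) , λ ()
  ok (inj₂ x) (inj₂ y) x≢y _ _ = (λ _ _ → b-multipartite x y (x≢y ∘ cong inj₂)) , λ ()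
withIsolated-PolarAvoiding {k} {W} {b} cl c₀ b-multipartite b-avoiding (inj₂ w)
  with b-avoiding w
... | sideW , cliqueW , okW = side , (λ _ → 0) , clique , ok
  where
  side : Fin (suc k) ⊎ W → Bool
  side (inj₁ _) = true
  side (inj₂ x) = sideW x
  clique : Fin (suc k) ⊎ W → Fin k
  clique (inj₁ _) = c₀
  clique (inj₂ x) = cliqueW x
  ok : ∀ u v → u ≢ v → u ≢ inj₂ w → v ≢ inj₂ w →
       PolarPair (withIsolated (suc k) b) side (λ _ → 0) clique u v
  ok (inj₁ _) (inj₁ _) _ _ _ = (λ _ _ → non-edge-same-part refl refl) , λ ()
  ok (inj₁ _) (inj₂ _) _ _ _ = (λ _ _ → non-edge-same-part refl refl) , λ ()
  ok (inj₂ _) (inj₁ _) _ _ _ = (λ _ _ → non-edge-same-part refl refl) , λ _ ()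
  ok (inj₂ x) (inj₂ y) x≢y x≢w y≢w = okW x y (x≢y ∘ cong inj₂) (x≢w ∘ cong inj₂) (y≢w ∘ cong inj₂)

withIsolated-multipartite-P₄-free : ∀ {m r W} (cl : W → Fin r) → P₄-free (withIsolated m (multipartite cl))
withIsolated-multipartite-P₄-free {m} cl (embedding f _ f-adj) =
  no-P₄ (f (# 0)) (f (# 1)) (f (# 2)) (f (# 3))
        (f-adj (# 0) (# 1)) (f-adj (# 1) (# 2)) (f-adj (# 2) (# 3)) (f-adj (# 0) (# 2)) (f-adj (# 1) (# 3)) (f-adj (# 0) (# 3))
  where
  a : Adj (Fin m ⊎ _)
  a = withIsolated m (multipartite cl)
  same-class : ∀ {x y} → multipartite cl x y ≡ false → cl x ≡ cl y
  same-class {x} {y} e = decidable-stable (_ Fin.≟ _) λ ne →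
    contradiction (trans (sym (⇐ (multipartite⇔ cl x y) ne)) e) λ ()
  -- The end x₃ is in the class of both x₀ and x₁, which are adjacent.
  no-P₄ : ∀ x₀ x₁ x₂ x₃ → a x₀ x₁ ≡ true → a x₁ x₂ ≡ true → a x₂ x₃ ≡ true →
          a x₀ x₂ ≡ false → a x₁ x₃ ≡ false → a x₀ x₃ ≡ false → ⊥
  no-P₄ (inj₂ x₀) (inj₂ x₁) (inj₂ _) (inj₂ _) e₀₁ _ _ _ e₁₃ e₀₃ =
    ⇒ (multipartite⇔ cl x₀ x₁) e₀₁ (trans (same-class e₀₃) (sym (same-class e₁₃)))
  no-P₄ (inj₁ _) (inj₁ _) _        _        () _  _  _ _ _
  no-P₄ (inj₁ _) (inj₂ _) _        _        () _  _  _ _ _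
  no-P₄ (inj₂ _) (inj₁ _) _        _        () _  _  _ _ _
  no-P₄ (inj₂ _) (inj₂ _) (inj₁ _) _        _  () _  _ _ _
  no-P₄ (inj₂ _) (inj₂ _) (inj₂ _) (inj₁ _) _  _  () _ _ _

withIsolated-HasType : ∀ {k W} {b : Adj W} (G : Graph) → (∀ x y → Reachable b x y) →
  {x₀ y₀ : W} → x₀ ≢ y₀ → adj G ≃ withIsolated (suc k) b → HasType G (suc (suc k)) (suc k)
withIsolated-HasType {k} {W} {b} G connected {x₀} {y₀} x₀≢y₀ (iso f f-adj) =
  comp ∘ to f , covered , reach , ⇐ (countB≡m⇔one-false trivial) (zero , big-nontrivial , others-trivial)
  where
  comp : Fin (suc k) ⊎ W → Fin (suc (suc k))
  comp (inj₁ i) = suc i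
  comp (inj₂ _) = zero

  covered : ∀ j → ∃ λ u → comp (to f u) ≡ j
  covered zero    = from f (inj₂ x₀) , cong comp (strictlyInverseˡ f _)
  covered (suc i) = from f (inj₁ i)  , cong comp (strictlyInverseˡ f _)

  same-comp⇒reachable : ∀ x y → comp x ≡ comp y → Reachable (withIsolated (suc k) b) x y
  same-comp⇒reachable (inj₁ i) (inj₁ j) e with Finₚ.suc-injective e
  ... | refl = here
  same-comp⇒reachable (inj₂ x) (inj₂ y) _ = Reachable-map inj₂ (λ _ _ e → e) (connected x y)

  reachable⇒same-comp : ∀ {x y} → Reachable (withIsolated (suc k) b) x y → comp x ≡ comp y
  reachable⇒same-comp here = refl
  reachable⇒same-comp {inj₂ _} (step {w = inj₂ _} _ r) = reachable⇒same-comp r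
  reachable⇒same-comp {inj₁ _} (step {w = inj₁ _} () _)
  reachable⇒same-comp {inj₁ _} (step {w = inj₂ _} () _)
  reachable⇒same-comp {inj₂ _} (step {w = inj₁ _} () _)

  reach : ∀ u v → (comp (to f u) ≡ comp (to f v) ⇔ Reach G u v)
  reach u v = mk⇔ (⇐ Reach⇔Reachable ∘ ⇐ (Reachable-≃ (iso f f-adj)) ∘ same-comp⇒reachable _ _)
                  (reachable⇒same-comp ∘ ⇒ (Reachable-≃ (iso f f-adj)) ∘ ⇒ Reach⇔Reachable)

  in-comp : Fin (suc (suc k)) → Fin (n G) → Bool
  in-comp j u = comp (to f u) ≡ᶠ j

  trivial : Fin (suc (suc k)) → Bool
  trivial j = countB (in-comp j) ℕ.≡ᵇ 1

  big-nontrivial : trivial zero ≡ false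
  big-nontrivial = ¬-not λ t → x₀≢y₀ (inj₂-injective (trans (sym (strictlyInverseˡ f _))
    (trans (cong (to f) (countB≡1⇒unique (in-comp zero) (⇒ ≡ᵇ⇔≡ t) (in-big x₀) (in-big y₀)))
           (strictlyInverseˡ f _))))
    where
    in-big : ∀ x → in-comp zero (from f (inj₂ x)) ≡ true
    in-big x = ⇐ ≡ᶠ⇔≡ (cong comp (strictlyInverseˡ f _))

  others-trivial : ∀ j → j ≢ zero → trivial j ≡ true
  others-trivial zero    0≢0 = contradiction refl 0≢0
  others-trivial (suc i) _   =
    ⇐ ≡ᵇ⇔≡ (unique⇒countB≡1 (in-comp (suc i)) (⇐ ≡ᶠ⇔≡ (cong comp (strictlyInverseˡ f _))) only)
    where
    only : ∀ w → in-comp (suc i) w ≡ true → w ≡ from f (inj₁ i)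
    only w e = trans (sym (strictlyInverseʳ f w)) (cong (from f) (comp-suc (to f w) (⇒ ≡ᶠ⇔≡ e)))
      where
      comp-suc : ∀ x → comp x ≡ suc i → x ≡ inj₁ i
      comp-suc (inj₁ _) e = cong inj₁ (Finₚ.suc-injective e)

copies-K₁⊹multipartite⇒obstruction : ∀ {k r W} (G H : Graph) (cl : W → Fin r) → Fin k → W →
  (∀ x → ∃ λ y → cl y ≢ cl x) → ¬ Polar₁ k (multipartite cl) → (∀ w → Polar₁Avoiding k (multipartite cl) w) →
  adj H ≃ multipartite cl → G ≅ (copies (suc k) K₁ ⊹ H) →
  CographMinObstruction k G × HasType G (suc (suc k)) (suc k)
copies-K₁⊹multipartite⇒obstruction {k} G H cl c₀ w₀ other ¬polar₁ avoiding H≃ G≅ =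
  ( (λ (f , f-inj , f-adj) → P₄-free-⊑ (≃⇒⊑ G≃) (withIsolated-multipartite-P₄-free cl) (embedding f f-inj f-adj))
  , withIsolated-not-Polar ¬polar₁ G≃
  , PolarAvoiding⇒PolarBelow (≃⇒⊑ G≃)
      (withIsolated-PolarAvoiding (Fin.toℕ ∘ cl) c₀ multipartite⇔toℕ avoiding) )
  , withIsolated-HasType G (multipartite-connected cl other) (≢-sym (proj₂ (other w₀)) ∘ cong cl) G≃
  where
  G≃ : adj G ≃ withIsolated (suc k) (multipartite cl)
  G≃ = ≃-trans (⇒ (≅⇔≃ {G} {copies (suc k) K₁ ⊹ H}) G≅) (copies-K₁⊹≃ (suc k) H H≃)
  multipartite⇔toℕ : ∀ x y → x ≢ y → (multipartite cl x y ≡ true ⇔ Fin.toℕ (cl x) ≢ Fin.toℕ (cl y))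
  multipartite⇔toℕ x y _ = mk⇔ (λ e → ⇒ (multipartite⇔ cl x y) e ∘ Finₚ.toℕ-injective)
                                 (λ ne → ⇐ (multipartite⇔ cl x y) (ne ∘ cong Fin.toℕ))

-- The obstruction (k+1)K₁ + K_{k+1,k+1}

bipartition : ∀ {m} → Fin m ⊎ Fin m → Fin 2
bipartition (inj₁ _) = zero
bipartition (inj₂ _) = suc zero

K[m,m]≃ : ∀ m → adj K[ m , m ] ≃ multipartite (bipartition {m})
K[m,m]≃ m = ≃-trans (combine≃ true (Empty m) (Empty m)) (≗⇒≃ λ
  { (inj₁ _) (inj₁ _) → refl
  ; (inj₁ _) (inj₂ _) → refl
  ; (inj₂ _) (inj₁ _) → refl
  ; (inj₂ _) (inj₂ _) → refl })

bipartition-other : ∀ {m} (x : Fin m ⊎ Fin m) → ∃ λ (y : Fin m ⊎ Fin m) → bipartition y ≢ bipartition x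
bipartition-other (inj₁ i) = inj₂ i , λ ()
bipartition-other (inj₂ i) = inj₁ i , λ ()

K[k+1,k+1]-not-Polar₁ : ∀ {k} → ¬ Polar₁ k (multipartite (bipartition {suc k}))
K[k+1,k+1]-not-Polar₁ {k} (side , clique , ok) with Finₚ.any? (λ i → side (inj₁ i) Bool.≟ true)
... | no none-in-A = independent-in-cluster {side = side} {λ _ → 0} {clique} {multipartite bipartition} inj₁
        (λ i j i≢j → ok _ _ (i≢j ∘ inj₁-injective)) (λ i → ¬-not (none-in-A ∘ (i ,_))) (λ _ _ _ → refl)
... | yes (i , i∈A) = independent-in-cluster {side = side} {λ _ → 0} {clique} {multipartite bipartition} inj₂
        (λ i j i≢j → ok _ _ (i≢j ∘ inj₂-injective))
        (λ j → ¬-not λ j∈A → ⇒ (proj₁ (ok (inj₁ i) (inj₂ j) λ ()) i∈A j∈A) refl refl)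
        (λ _ _ _ → refl)

K[k+1,k+1]-Polar₁Avoiding : ∀ {k} → Fin k → ∀ w → Polar₁Avoiding k (multipartite (bipartition {suc k})) w
K[k+1,k+1]-Polar₁Avoiding {k} c₀ (inj₁ i) = side , clique , ok
  where
  side : Fin (suc k) ⊎ Fin (suc k) → Bool
  side (inj₁ _) = false
  side (inj₂ _) = true
  clique : Fin (suc k) ⊎ Fin (suc k) → Fin k
  clique (inj₁ j) = relabel-without c₀ i j
  clique (inj₂ _) = c₀
  ok : ∀ u v → u ≢ v → u ≢ inj₁ i → v ≢ inj₁ i → PolarPair (multipartite bipartition) side (λ _ → 0) clique u v
  ok (inj₁ j) (inj₁ j′) j≢j′ j≢i j′≢i = (λ ()) , λ _ _ → mk⇔ (λ ()) λ e →
    contradiction (cong inj₁ (relabel-without-injective c₀ (j≢i ∘ cong inj₁) (j′≢i ∘ cong inj₁) e)) j≢j′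
  ok (inj₁ _) (inj₂ _) _ _ _ = (λ ()) , λ _ ()
  ok (inj₂ _) (inj₁ _) _ _ _ = (λ _ ()) , λ ()
  ok (inj₂ _) (inj₂ _) _ _ _ = (λ _ _ → non-edge-same-part refl refl) , λ ()
K[k+1,k+1]-Polar₁Avoiding {k} c₀ (inj₂ i) = side , clique , ok
  where
  side : Fin (suc k) ⊎ Fin (suc k) → Bool
  side (inj₁ _) = true
  side (inj₂ _) = false
  clique : Fin (suc k) ⊎ Fin (suc k) → Fin k
  clique (inj₁ _) = c₀
  clique (inj₂ j) = relabel-without c₀ i j
  ok : ∀ u v → u ≢ v → u ≢ inj₂ i → v ≢ inj₂ i → PolarPair (multipartite bipartition) side (λ _ → 0) clique u v
  ok (inj₂ j) (inj₂ j′) j≢j′ j≢i j′≢i = (λ ()) , λ _ _ → mk⇔ (λ ()) λ e →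
    contradiction (cong inj₂ (relabel-without-injective c₀ (j≢i ∘ cong inj₂) (j′≢i ∘ cong inj₂) e)) j≢j′
  ok (inj₂ _) (inj₁ _) _ _ _ = (λ ()) , λ _ ()
  ok (inj₁ _) (inj₂ _) _ _ _ = (λ _ ()) , λ ()
  ok (inj₁ _) (inj₁ _) _ _ _ = (λ _ _ → non-edge-same-part refl refl) , λ ()

-- The obstruction (k+1)K₁ + K₁ ⊕ C₄

-- In K₁ ⊕ C₄ the apex is 0 and the cycle is 1-2-3-4-1.
K₁⊕C₄-class : Fin 5 → Fin 3
K₁⊕C₄-class = # 0 ∷ # 1 ∷ # 2 ∷ # 1 ∷ # 2 ∷ []

K₁⊕C₄≃ : adj (K₁ ⊕ C₄) ≃ multipartite K₁⊕C₄-class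
K₁⊕C₄≃ = ≗⇒≃ (toWitness {a? = Finₚ.all? λ u → Finₚ.all? λ v →
                                 adj (K₁ ⊕ C₄) u v Bool.≟ multipartite K₁⊕C₄-class u v} _)

K₁⊕C₄-other : ∀ x → ∃ λ y → K₁⊕C₄-class y ≢ K₁⊕C₄-class x
K₁⊕C₄-other = toWitness {a? = Finₚ.all? λ x → Finₚ.any? λ y → ¬? (K₁⊕C₄-class y Fin.≟ K₁⊕C₄-class x)} _

K₁⊕C₄-antipode : Fin 5 → Fin 5
K₁⊕C₄-antipode = # 0 ∷ # 3 ∷ # 4 ∷ # 1 ∷ # 2 ∷ []

K₁⊕C₄-same-class : ∀ x y → x ≢ y → K₁⊕C₄-class x ≡ K₁⊕C₄-class y → y ≡ K₁⊕C₄-antipode x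
K₁⊕C₄-same-class = toWitness {a? = Finₚ.all? λ x → Finₚ.all? λ y →
  ¬? (x Fin.≟ y) →-dec K₁⊕C₄-class x Fin.≟ K₁⊕C₄-class y →-dec y Fin.≟ K₁⊕C₄-antipode x} _

K₁⊕C₄-not-Polar₁ : ∀ {k} → ¬ Polar₁ k (multipartite K₁⊕C₄-class)
K₁⊕C₄-not-Polar₁ (side , clique , ok) = apex-side (side (# 0)) refl
  where
  a : Adj (Fin 5)
  a = multipartite K₁⊕C₄-class

  leaves-A : ∀ {x y} → x ≢ y → side x ≡ true → a x y ≡ true → side y ≡ false
  leaves-A {x} {y} x≢y x∈A e = ¬-not λ y∈A → ⇒ (proj₁ (ok x y x≢y) x∈A y∈A) e refl

  P₃-in-B : ∀ {x y z} → x ≢ y → y ≢ z → x ≢ z → side x ≡ false → side y ≡ false → side z ≡ false →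
            a x y ≡ true → a y z ≡ true → a x z ≡ false → ⊥
  P₃-in-B x≢y y≢z x≢z =
    no-induced-P₃-in-cluster {side = side} {λ _ → 0} {clique} {a} (ok _ _ x≢y) (ok _ _ y≢z) (ok _ _ x≢z)

  -- With the apex in A the cycle lies in B; otherwise the apex and a pair of opposite cycle
  -- vertices outside A form an induced P₃ in B.
  apex-side : ∀ s → side (# 0) ≡ s → ⊥
  apex-side true  0∈A = P₃-in-B {# 1} {# 2} {# 3} (λ ()) (λ ()) (λ ())
    (leaves-A (λ ()) 0∈A refl) (leaves-A (λ ()) 0∈A refl) (leaves-A (λ ()) 0∈A refl) refl refl refl
  apex-side false 0∈B with side (# 1) in s₁ | side (# 3) in s₃
  ... | false | false = P₃-in-B {# 1} {# 0} {# 3} (λ ()) (λ ()) (λ ()) s₁ 0∈B s₃ refl refl refl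
  ... | true  | _     = P₃-in-B {# 2} {# 0} {# 4} (λ ()) (λ ()) (λ ())
    (leaves-A (λ ()) s₁ refl) 0∈B (leaves-A (λ ()) s₁ refl) refl refl refl
  ... | false | true  = P₃-in-B {# 2} {# 0} {# 4} (λ ()) (λ ()) (λ ())
    (leaves-A (λ ()) s₃ refl) 0∈B (leaves-A (λ ()) s₃ refl) refl refl refl

-- Without the apex, the class {1, 3} forms A and {2}, {4} are two cliques; without a cycle
-- vertex, the other class forms A and the apex with the remaining vertex of its class is a clique.
K₁⊕C₄-Polar₁Avoiding : ∀ {k} → ∀ w → Polar₁Avoiding (suc (suc k)) (multipartite K₁⊕C₄-class) w
K₁⊕C₄-Polar₁Avoiding {k} w = Polar₁Avoiding-by-decision _ (side w) (clique w) w (decided w)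
  where
  A₁₃ A₂₄ : Fin 5 → Bool
  A₁₃ = false ∷ true ∷ false ∷ true ∷ false ∷ []
  A₂₄ = false ∷ false ∷ true ∷ false ∷ true ∷ []
  side : Fin 5 → Fin 5 → Bool
  side = A₁₃ ∷ A₂₄ ∷ A₁₃ ∷ A₂₄ ∷ A₁₃ ∷ []
  clique : Fin 5 → Fin 5 → Fin (suc (suc k))
  clique zero    = zero ∷ zero ∷ zero ∷ zero ∷ suc zero ∷ []
  clique (suc _) = λ _ → zero
  decided : ∀ w → True (Polar₁Avoiding? (multipartite K₁⊕C₄-class) (side w) (clique w) w)
  decided zero                         = _
  decided (suc zero)                   = _
  decided (suc (suc zero))             = _
  decided (suc (suc (suc zero)))       = _
  decided (suc (suc (suc (suc zero)))) = _

-- Structure of a minimal obstruction of type (k+2, k+1)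

module Classification {k : ℕ} (c₀ : Fin k) (G : Graph) (nonpolar : ¬ Polar k (adj G))
                      (below : PolarBelow k (adj G)) (type : HasType G (suc (suc k)) (suc k)) where

  private
    V : Set
    V = Fin (n G)
    a : Adj V
    a = adj G

  comp : V → Fin (suc (suc k))
  comp = proj₁ type

  covered : ∀ j → ∃ λ u → comp u ≡ j
  covered = proj₁ (proj₂ type)

  same-comp⇔Reach : ∀ u v → (comp u ≡ comp v ⇔ Reach G u v)
  same-comp⇔Reach = proj₁ (proj₂ (proj₂ type))

  j₀ : Fin (suc (suc k))
  j₀ = proj₁ (all-trivial-but-one type)

  others-trivial : ∀ j → j ≢ j₀ → ∀ {x y} → comp x ≡ j → comp y ≡ j → x ≡ y
  others-trivial = proj₂ (all-trivial-but-one type)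

  InH : V → Set
  InH u = comp u ≡ j₀

  InH? : Decidable InH
  InH? u = comp u Fin.≟ j₀

  outside-H-isolated : ∀ {u} → ¬ InH u → ∀ w → a u w ≡ false
  outside-H-isolated {u} u∉H w = ¬-not λ e →
    let u≡w = others-trivial (comp u) u∉H refl (sym (⇐ (same-comp⇔Reach u w) (step e here)))
    in contradiction (trans (sym (subst (λ x → a x w ≡ true) u≡w e)) (irr G w)) λ ()

  edge⇒InH : ∀ {u v} → a u v ≡ true → InH u × InH v
  edge⇒InH {u} {v} e =
    decidable-stable (InH? u) (λ u∉H → contradiction (trans (sym e) (outside-H-isolated u∉H v)) λ ()) ,
    decidable-stable (InH? v) (λ v∉H →
      contradiction (trans (sym e) (trans (Graph.sym G u v) (outside-H-isolated v∉H u))) λ ())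

  isolated-vertex : Fin (suc k) → V
  isolated-vertex i = proj₁ (covered (punchIn j₀ i))

  isolated-vertex-∉H : ∀ i → ¬ InH (isolated-vertex i)
  isolated-vertex-∉H i = Finₚ.punchInᵢ≢i j₀ i ∘ trans (sym (proj₂ (covered (punchIn j₀ i))))

  isolated-vertex-injective : Injective _≡_ _≡_ isolated-vertex
  isolated-vertex-injective {i} {j} e = Finₚ.punchIn-injective j₀ i j
    (trans (sym (proj₂ (covered _))) (trans (cong comp e) (proj₂ (covered _))))

  no-edge-from-isolated : ∀ i w → a (isolated-vertex i) w ≡ false
  no-edge-from-isolated i = outside-H-isolated (isolated-vertex-∉H i)

  no-edge-to-isolated : ∀ i w → a w (isolated-vertex i) ≡ false
  no-edge-to-isolated i w = trans (Graph.sym G w _) (no-edge-from-isolated i w)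

  H≢isolated : ∀ {h} i → InH h → h ≢ isolated-vertex i
  H≢isolated i h∈H refl = isolated-vertex-∉H i h∈H

  G-x₀ : PolarAvoiding k a (isolated-vertex zero)
  G-x₀ = PolarBelow⇒PolarAvoiding c₀ below (isolated-vertex zero)

  side₀ : V → Bool
  side₀ = proj₁ G-x₀

  part : V → ℕ
  part = proj₁ (proj₂ G-x₀)

  clique₀ : V → Fin k
  clique₀ = proj₁ (proj₂ (proj₂ G-x₀))

  ok₀ : ∀ u v → u ≢ v → u ≢ isolated-vertex zero → v ≢ isolated-vertex zero →
        PolarPair a side₀ part clique₀ u v
  ok₀ = proj₂ (proj₂ (proj₂ G-x₀))

  -- Otherwise the deleted vertex could join that isolated vertex's part.
  other-isolated-in-B : ∀ i → side₀ (isolated-vertex (suc i)) ≡ false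
  other-isolated-in-B i = ¬-not λ in-A → nonpolar (Polar-false-twin G (Finₚ.0≢1+n ∘ isolated-vertex-injective)
    (λ v → trans (no-edge-from-isolated zero v) (sym (no-edge-from-isolated (suc i) v))) G-x₀ in-A)

  -- The k other isolated vertices already occupy all k cliques.
  H-in-A : ∀ {h} → InH h → side₀ h ≡ true
  H-in-A {h} h∈H = ¬-not λ in-B →
    independent-in-cluster {side = side₀} {part} {clique₀} {a} g
      (λ i j i≢j → ok₀ (g i) (g j) (g-distinct i j i≢j) (g≢x₀ i) (g≢x₀ j))
      (λ { zero → in-B ; (suc i) → other-isolated-in-B i })
      g-independent
    where
    g : Fin (suc k) → V
    g = h ∷ isolated-vertex ∘ suc
    g-distinct : ∀ i j → i ≢ j → g i ≢ g j
    g-distinct zero    zero    0≢0 _ = 0≢0 refl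
    g-distinct zero    (suc j) _     = H≢isolated (suc j) h∈H
    g-distinct (suc i) zero    _     = ≢-sym (H≢isolated (suc i) h∈H)
    g-distinct (suc i) (suc j) i≢j   = i≢j ∘ cong suc ∘ Finₚ.suc-injective ∘ isolated-vertex-injective
    g≢x₀ : ∀ i → g i ≢ isolated-vertex zero
    g≢x₀ zero    = H≢isolated zero h∈H
    g≢x₀ (suc i) = ≢-sym Finₚ.0≢1+n ∘ isolated-vertex-injective
    g-independent : ∀ i j → i ≢ j → a (g i) (g j) ≡ false
    g-independent zero    zero    0≢0 = contradiction refl 0≢0
    g-independent zero    (suc j) _   = no-edge-to-isolated (suc j) h
    g-independent (suc i) j       _   = no-edge-from-isolated (suc i) (g j)

  H≢x₀ : ∀ {h} → InH h → h ≢ isolated-vertex zero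
  H≢x₀ = H≢isolated zero

  H-multipartite : ∀ {x y} → InH x → InH y → x ≢ y → (a x y ≡ true ⇔ part x ≢ part y)
  H-multipartite x∈H y∈H x≢y = proj₁ (ok₀ _ _ x≢y (H≢x₀ x∈H) (H≢x₀ y∈H)) (H-in-A x∈H) (H-in-A y∈H)

  same-part-non-adjacent : ∀ {x y} → InH x → InH y → part x ≡ part y → a x y ≡ false
  same-part-non-adjacent {x} {y} x∈H y∈H same with x Fin.≟ y
  ... | yes refl = irr G x
  ... | no x≢y   = ¬-not λ e → ⇒ (H-multipartite x∈H y∈H x≢y) e same

  different-part-adjacent : ∀ {x y} → InH x → InH y → part x ≢ part y → a x y ≡ true
  different-part-adjacent x∈H y∈H differ = ⇐ (H-multipartite x∈H y∈H λ { refl → differ refl }) differ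

  InPart : ℕ → V → Set
  InPart q u = InH u × part u ≡ q

  InPart? : ∀ q → Decidable (InPart q)
  InPart? q u = InH? u ×-dec part u ≟ q

  PartPair : ℕ → Set
  PartPair p = ∃₂ λ y y′ → y ≢ y′ × InPart p y × InPart p y′

  -- Otherwise all parts but that of x are singletons: they form one clique, the rest one part.
  repeated-part : ∀ {x} → InH x → ∃ λ p → p ≢ part x × PartPair p
  repeated-part {x} x∈H with Finₚ.any? (λ y → Finₚ.any? λ y′ →
    InH? y ×-dec InH? y′ ×-dec ¬? (y Fin.≟ y′) ×-dec part y ≟ part y′ ×-dec ¬? (part y ≟ part x))
  ... | yes (y , y′ , y∈H , y′∈H , y≢y′ , same , differ) =
    part y , differ , y , y′ , y≢y′ , (y∈H , refl) , (y′∈H , sym same)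
  ... | no none = ⊥-elim (nonpolar (Polar-from-split InB? (λ _ → c₀) independent cluster))
    where
    InB : V → Set
    InB u = InH u × part u ≢ part x
    InB? : Decidable InB
    InB? u = InH? u ×-dec ¬? (part u ≟ part x)
    independent : ∀ u v → u ≢ v → ¬ InB u → ¬ InB v → a u v ≡ false
    independent u v _ u∉B v∉B = ¬-not λ e → let (u∈H , v∈H) = edge⇒InH e in
      contradiction (trans (sym e)
        (same-part-non-adjacent u∈H v∈H (trans (decidable-stable (_ ≟ _) (u∉B ∘ (u∈H ,_)))
                                        (sym (decidable-stable (_ ≟ _) (v∉B ∘ (v∈H ,_)))))))
        λ ()
    cluster : ∀ u v → u ≢ v → InB u → InB v → (a u v ≡ true ⇔ c₀ ≡ c₀)
    cluster u v u≢v (u∈H , u∉x) (v∈H , _) = mk⇔ (λ _ → refl) λ _ →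
      different-part-adjacent u∈H v∈H λ same → none (u , v , u∈H , v∈H , u≢v , same , u∉x)

  -- Otherwise the at most k vertices of part q are singleton cliques and the rest one part.
  large-part : ∀ {p q} → (∀ {u} → InH u → part u ≡ p ⊎ part u ≡ q) →
    Σ (Fin (suc k) → V) λ g → Injective _≡_ _≡_ g × ∀ i → InPart q (g i)
  large-part {p} {q} two-parts with choose-or-label (InPart? q) k
  ... | inj₁ large = large
  ... | inj₂ (f , f-inj) = ⊥-elim (nonpolar (Polar-from-split (InPart? q) clique independent cluster))
    where
    clique : V → Fin k
    clique u with InPart? q u
    ... | yes u∈B = f u u∈B
    ... | no _    = c₀
    part-p : ∀ {u} → InH u → ¬ InPart q u → part u ≡ p
    part-p {u} u∈H u∉B with two-parts u∈H
    ... | inj₁ is-p = is-p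
    ... | inj₂ is-q = contradiction (u∈H , is-q) u∉B
    independent : ∀ u v → u ≢ v → ¬ InPart q u → ¬ InPart q v → a u v ≡ false
    independent u v _ u∉B v∉B = ¬-not λ e → let (u∈H , v∈H) = edge⇒InH e in
      contradiction (trans (sym e) (same-part-non-adjacent u∈H v∈H (trans (part-p u∈H u∉B) (sym (part-p v∈H v∉B)))))
        λ ()
    cluster : ∀ u v → u ≢ v → InPart q u → InPart q v → (a u v ≡ true ⇔ clique u ≡ clique v)
    cluster u v u≢v (u∈H , u-q) (v∈H , v-q) with InPart? q u | InPart? q v
    ... | yes u∈B | yes v∈B = mk⇔
      (λ e → contradiction (trans (sym e) (same-part-non-adjacent u∈H v∈H (trans u-q (sym v-q)))) λ ())
      (λ same-clique → contradiction (f-inj u∈B v∈B same-clique) u≢v)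
    ... | no u∉B | _       = contradiction (u∈H , u-q) u∉B
    ... | _      | no v∉B  = contradiction (v∈H , v-q) v∉B

  multipartite-in-H : ∀ {r W} → DecidableEquality W → (cl : W → Fin r) (P : Fin r → ℕ) → Injective _≡_ _≡_ P →
    (φ : W → V) → (∀ x → InH (φ x)) → (∀ x → part (φ x) ≡ P (cl x)) →
    (∀ x y → x ≢ y → cl x ≡ cl y → φ x ≢ φ y) → withIsolated (suc k) (multipartite cl) ⊑ a
  multipartite-in-H {W = W} _≟W_ cl P P-inj φ φ∈H part-φ separates = embedding ψ ψ-injective ψ-adj
    where
    same-part⇒same-class : ∀ {x y} → part (φ x) ≡ part (φ y) → cl x ≡ cl y
    same-part⇒same-class {x} {y} e = P-inj (trans (sym (part-φ x)) (trans e (part-φ y)))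

    φ-injective : Injective _≡_ _≡_ φ
    φ-injective {x} {y} e = decidable-stable (x ≟W y) λ x≢y →
      separates x y x≢y (same-part⇒same-class (cong part e)) e

    ψ : Fin (suc k) ⊎ W → V
    ψ (inj₁ i) = isolated-vertex i
    ψ (inj₂ x) = φ x

    ψ-injective : Injective _≡_ _≡_ ψ
    ψ-injective {inj₁ i} {inj₁ j} e = cong inj₁ (isolated-vertex-injective e)
    ψ-injective {inj₁ i} {inj₂ y} e = contradiction (sym e) (H≢isolated i (φ∈H y))
    ψ-injective {inj₂ x} {inj₁ j} e = contradiction e (H≢isolated j (φ∈H x))
    ψ-injective {inj₂ x} {inj₂ y} e = cong inj₂ (φ-injective e)

    φ-adj : ∀ x y → a (φ x) (φ y) ≡ true ⇔ multipartite cl x y ≡ true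
    φ-adj x y with x ≟W y
    ... | yes refl = mk⇔ (λ e → contradiction (trans (sym e) (irr G (φ x))) λ ())
                         (λ e → contradiction (trans (sym e) (cong not (⇐ (≡ᶠ⇔≡ {i = cl x}) refl))) λ ())
    ... | no x≢y = mk⇔
      (λ e → ⇐ (multipartite⇔ cl x y) λ same → ⇒ (H-multipartite (φ∈H x) (φ∈H y) (x≢y ∘ φ-injective)) e
               (trans (part-φ x) (trans (cong P same) (sym (part-φ y)))))
      (λ e → different-part-adjacent (φ∈H x) (φ∈H y) (⇒ (multipartite⇔ cl x y) e ∘ same-part⇒same-class))

    ψ-adj : ∀ u v → a (ψ u) (ψ v) ≡ withIsolated (suc k) (multipartite cl) u v
    ψ-adj (inj₁ i) (inj₁ j) = no-edge-from-isolated i (ψ (inj₁ j))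
    ψ-adj (inj₁ i) (inj₂ y) = no-edge-from-isolated i (φ y)
    ψ-adj (inj₂ x) (inj₁ j) = no-edge-to-isolated j (φ x)
    ψ-adj (inj₂ x) (inj₂ y) = ⇔→≡ (φ-adj x y)

  multipartite-in-H⇒≅ : ∀ {r W} (H′ : Graph) (cl : W → Fin r) → adj H′ ≃ multipartite cl →
    ¬ Polar₁ k (multipartite cl) → withIsolated (suc k) (multipartite cl) ⊑ a → G ≅ (copies (suc k) K₁ ⊹ H′)
  multipartite-in-H⇒≅ H′ cl H′≃ ¬polar₁ ⊑G =
    ⇐ (≅⇔≃ {G} {copies (suc k) K₁ ⊹ H′})
      (PolarBelow-⊑⇒≃ below (withIsolated-not-Polar ¬polar₁ T≃) (⊑-trans (≃⇒⊑ T≃) ⊑G))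
    where
    T≃ : adj (copies (suc k) K₁ ⊹ H′) ≃ withIsolated (suc k) (multipartite cl)
    T≃ = copies-K₁⊹≃ (suc k) H′ H′≃

  K₁⊕C₄-in-H : ∀ {w p q} → InH w → part w ≢ p → part w ≢ q → p ≢ q → PartPair p → PartPair q →
               G ≅ (copies (suc k) K₁ ⊹ (K₁ ⊕ C₄))
  K₁⊕C₄-in-H {w} {p} {q} w∈H w≢p w≢q p≢q (y , y′ , y≢y′ , y-p , y′-p) (z , z′ , z≢z′ , z-q , z′-q) =
    multipartite-in-H⇒≅ (K₁ ⊕ C₄) K₁⊕C₄-class K₁⊕C₄≃ K₁⊕C₄-not-Polar₁
      (multipartite-in-H Fin._≟_ K₁⊕C₄-class P P-injective φ (proj₁ ∘ in-part) (proj₂ ∘ in-part) separates)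
    where
    φ : Fin 5 → V
    φ = w ∷ y ∷ z ∷ y′ ∷ z′ ∷ []
    P : Fin 3 → ℕ
    P = part w ∷ p ∷ q ∷ []
    P-injective : Injective _≡_ _≡_ P
    P-injective {zero}             {zero}             _ = refl
    P-injective {zero}             {suc zero}         e = contradiction e w≢p
    P-injective {zero}             {suc (suc zero)}   e = contradiction e w≢q
    P-injective {suc zero}         {zero}             e = contradiction (sym e) w≢p
    P-injective {suc zero}         {suc zero}         _ = refl
    P-injective {suc zero}         {suc (suc zero)}   e = contradiction e p≢q
    P-injective {suc (suc zero)}   {zero}             e = contradiction (sym e) w≢q
    P-injective {suc (suc zero)}   {suc zero}         e = contradiction (sym e) p≢q
    P-injective {suc (suc zero)}   {suc (suc zero)}   _ = refl
    in-part : ∀ x → InPart (P (K₁⊕C₄-class x)) (φ x)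
    in-part zero                         = w∈H , refl
    in-part (suc zero)                   = y-p
    in-part (suc (suc zero))             = z-q
    in-part (suc (suc (suc zero)))       = y′-p
    in-part (suc (suc (suc (suc zero)))) = z′-q
    separates : ∀ x x′ → x ≢ x′ → K₁⊕C₄-class x ≡ K₁⊕C₄-class x′ → φ x ≢ φ x′
    separates x x′ x≢x′ same with refl ← K₁⊕C₄-same-class x x′ x≢x′ same = antipodes-differ x x≢x′
      where
      antipodes-differ : ∀ x → x ≢ K₁⊕C₄-antipode x → φ x ≢ φ (K₁⊕C₄-antipode x)
      antipodes-differ zero                               0≢0 = contradiction refl 0≢0
      antipodes-differ (suc zero)                         _   = y≢y′
      antipodes-differ (suc (suc zero))                   _   = z≢z′
      antipodes-differ (suc (suc (suc zero)))             _   = ≢-sym y≢y′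
      antipodes-differ (suc (suc (suc (suc zero))))       _   = ≢-sym z≢z′

  K[k+1,k+1]-in-H : ∀ {p q} → p ≢ q → (∀ {u} → InH u → part u ≡ p ⊎ part u ≡ q) →
                    G ≅ (copies (suc k) K₁ ⊹ K[ suc k , suc k ])
  K[k+1,k+1]-in-H {p} {q} p≢q two-parts with large-part (swap ∘ two-parts) | large-part two-parts
  ... | gp , gp-inj , gp-p | gq , gq-inj , gq-q =
    multipartite-in-H⇒≅ K[ suc k , suc k ] bipartition (K[m,m]≃ (suc k)) K[k+1,k+1]-not-Polar₁
      (multipartite-in-H (Sumₚ.≡-dec Fin._≟_ Fin._≟_) bipartition P P-injective φ φ∈H part-φ separates)
    where
    φ : Fin (suc k) ⊎ Fin (suc k) → V
    φ (inj₁ i) = gp i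
    φ (inj₂ i) = gq i
    P : Fin 2 → ℕ
    P = p ∷ q ∷ []
    P-injective : Injective _≡_ _≡_ P
    P-injective {zero}     {zero}     _ = refl
    P-injective {zero}     {suc zero} e = contradiction e p≢q
    P-injective {suc zero} {zero}     e = contradiction (sym e) p≢q
    P-injective {suc zero} {suc zero} _ = refl
    φ∈H : ∀ x → InH (φ x)
    φ∈H (inj₁ i) = proj₁ (gp-p i)
    φ∈H (inj₂ i) = proj₁ (gq-q i)
    part-φ : ∀ x → part (φ x) ≡ P (bipartition x)
    part-φ (inj₁ i) = proj₂ (gp-p i)
    part-φ (inj₂ i) = proj₂ (gq-q i)
    separates : ∀ x x′ → x ≢ x′ → bipartition x ≡ bipartition x′ → φ x ≢ φ x′
    separates (inj₁ i) (inj₁ j) i≢j _ = i≢j ∘ cong inj₁ ∘ gp-inj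
    separates (inj₂ i) (inj₂ j) i≢j _ = i≢j ∘ cong inj₂ ∘ gq-inj

  classify : (G ≅ (copies (suc k) K₁ ⊹ K[ suc k , suc k ])) ⊎ (G ≅ (copies (suc k) K₁ ⊹ (K₁ ⊕ C₄)))
  classify with repeated-part (proj₂ (covered j₀))
  ... | p , _ , pair-p@(y , _ , _ , (y∈H , refl) , _) with repeated-part y∈H
  ... | q , q≢p , pair-q with Finₚ.any? (λ w → InH? w ×-dec ¬? (part w ≟ p) ×-dec ¬? (part w ≟ q))
  ... | yes (w , w∈H , w≢p , w≢q) = inj₂ (K₁⊕C₄-in-H w∈H w≢p w≢q (≢-sym q≢p) pair-p pair-q)
  ... | no none = inj₁ (K[k+1,k+1]-in-H (≢-sym q≢p) two-parts)
    where
    two-parts : ∀ {u} → InH u → part u ≡ p ⊎ part u ≡ q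
    two-parts {u} u∈H with part u ≟ p | part u ≟ q
    ... | yes u-p | _     = inj₁ u-p
    ... | no _    | yes u-q = inj₂ u-q
    ... | no u≢p  | no u≢q  = contradiction (u , u∈H , u≢p , u≢q) none

ObstructionsOfType : ℕ → Graph → ℕ → ℕ → Set
ObstructionsOfType k G c i = (CographMinObstruction k G × HasType G c i) ⇔
  ((G ≅ (copies i K₁ ⊹ K[ i , i ])) ⊎ (G ≅ (copies i K₁ ⊹ (K₁ ⊕ C₄))))

obstructions-of-type : ∀ k G → ObstructionsOfType (suc (suc k)) G (suc (suc (suc (suc k)))) (suc (suc (suc k)))
obstructions-of-type k G = mk⇔
  (λ ((_ , nonpolar , below) , type) → Classification.classify zero G nonpolar below type)
  λ { (inj₁ G≅) → copies-K₁⊹multipartite⇒obstruction G K[ suc (suc (suc k)) , suc (suc (suc k)) ] bipartition zero (inj₁ zero) bipartition-other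
                     K[k+1,k+1]-not-Polar₁ (K[k+1,k+1]-Polar₁Avoiding zero) (K[m,m]≃ (suc (suc (suc k)))) G≅
    ; (inj₂ G≅) → copies-K₁⊹multipartite⇒obstruction G (K₁ ⊕ C₄) K₁⊕C₄-class zero zero K₁⊕C₄-other
                     K₁⊕C₄-not-Polar₁ K₁⊕C₄-Polar₁Avoiding K₁⊕C₄≃ G≅ }

theorem8 : (k : ℕ) → 2 ≤ k → (G : Graph) →
    ((CographMinObstruction k G × HasType G (k + 2) (k + 1)) ⇔
    ((G ≅ (copies (k + 1) K₁ ⊹ K[ k + 1 , k + 1 ])) ⊎
    (G ≅ (copies (k + 1) K₁ ⊹ (K₁ ⊕ C₄)))))
theorem8 (suc zero) (s≤s ()) _
theorem8 k@(suc (suc k′)) _ G =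
  subst₂ (ObstructionsOfType k G) (ℕₚ.+-comm 2 k) (ℕₚ.+-comm 1 k) (obstructions-of-type k′ G)
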